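{- Let $G$ be a graph, $\mathcal P\preceq\mathcal Q$ partitions of $V(G)$ (i.e. $\mathcal P$ refines $\mathcal Q$), $S\subseteq V(G)$, $r,k,\ell\in\mathbb N$, and $v\in V(G)$ such that $|\mathrm{Ball}^r_{\mathcal Q}(v)/\mathcal P|\le k$ and $|S\cap\mathrm{Ball}^{r+1}_{\mathcal Q}(v)|\le\ell$. Then for $\mathcal P'=\mathcal P\wedge S$ we have $|\mathrm{Ball}^r_{\mathcal Q}(v)/\mathcal P'|\le k\cdot\pi_G(\ell)$.
   Context: Graphs are finite, simple, undirected. $\pi_G(m)=\max_{A\subseteq V(G),|A|\le m}|\{N(v)\cap A:v\in V(G)\}|$. For a partition $\mathcal P$ of $V(G)$ and $X\subseteq V(G)$, $X/\mathcal P$ is the set of parts of $\mathcal P$ intersecting $X$. A $\mathcal Q$-flip of $G$ is obtained by choosing pairs $(X,Y)$ of parts of $\mathcal Q$ (possibly $X=Y$) and complementing the adjacency between all pairs of distinct vertices $x\in X,y\in Y$. $\mathrm{dist}_{\mathcal Q}(x,y)=\max\mathrm{dist}_{G'}(x,y)$ over all $\mathcal Q$-flips $G'$ of $G$, and $\mathrm{Ball}^r_{\mathcal Q}(v)=\{x:\mathrm{dist}_{\mathcal Q}(x,v)\le r\}$. The $S$-refinement $\mathcal P\wedge S$ of $\mathcal P$ is the partition in which $u,v$ are in the same part iff they lie in the same part $P\in\mathcal P$ and $N(u)\cap(S\setminus P)=N(v)\cap(S\setminus P)$. -}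

module Defs where

open import Data.Nat using (ℕ; zero; suc; _≤_; _⊔_)
open import Data.Nat.Properties using (_≤?_)
open import Data.Bool using (Bool; true; false; _∧_; not; _xor_)
open import Data.Bool.Properties using () renaming (_≟_ to _≟ᵇ_)
open import Data.Fin using (Fin)
open import Data.Fin.Properties using () renaming (_≟_ to _≟ᶠ_)
open import Data.Fin.Subset using (Subset; _∩_; ∣_∣; _∈_)
open import Data.Vec using (Vec; []; _∷_; tabulate)
open import Data.Vec.Properties using (≡-dec)
open import Data.List using (List; []; _∷_; map; _++_; length; deduplicate; allFin; foldr; filter)
open import Data.List.Membership.Propositional renaming (_∈_ to _∈ₗ_)
open import Data.Product using (Σ; ∃; _×_; _,_)
open import Relation.Nullary using (¬_; does)
open import Relation.Binary.PropositionalEquality using (_≡_; _≢_)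

record Graph (n : ℕ) : Set where
  field
    adj   : Fin n → Fin n → Bool
    sym   : ∀ x y → adj x y ≡ adj y x
    irrfl : ∀ x → adj x x ≡ false
open Graph public

-- A partition of V(G) is given by a labelling of the vertices; the parts
-- are the (nonempty) fibres of the labelling.
Partition : ℕ → Set → Set
Partition n L = Fin n → L

_⪯_ : ∀ {n L M} → Partition n L → Partition n M → Set
P ⪯ Q = ∀ x y → P x ≡ P y → Q x ≡ Q y

AtMost : {A : Set} → ℕ → (A → Set) → Set
AtMost {A} k X = Σ (List A) λ L → length L ≤ k × (∀ a → X a → a ∈ₗ L)

-- X/𝒫 : the set of parts of 𝒫 (identified with their labels) meeting X
_/ₚ_ : ∀ {n L} → (Fin n → Set) → Partition n L → (L → Set)
(X /ₚ P) i = ∃ λ x → X x × P x ≡ i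

N : ∀ {n} → Graph n → Fin n → Subset n
N G v = tabulate (λ u → adj G v u)

allSubsets : (n : ℕ) → List (Subset n)
allSubsets zero = [] ∷ []
allSubsets (suc n) = map (false ∷_) (allSubsets n) ++ map (true ∷_) (allSubsets n)

traces : ∀ {n} → Graph n → Subset n → ℕ
traces {n} G A = length (deduplicate (≡-dec _≟ᵇ_) (map (λ v → N G v ∩ A) (allFin n)))

π : ∀ {n} → Graph n → ℕ → ℕ
π {n} G m = foldr _⊔_ 0 (map (traces G) (filter (λ A → ∣ A ∣ ≤? m) (allSubsets n)))

-- 𝒬-flip of G: F is a symmetric choice of pairs of parts (labels) of 𝒬;
-- adjacency between distinct x, y is complemented iff F (Q x) (Q y).
flipAdj : ∀ {n L} → Graph n → Partition n L → (L → L → Bool) → Fin n → Fin n → Set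
flipAdj G Q F x y = x ≢ y × (adj G x y xor F (Q x) (Q y)) ≡ true

data Reach {n} (E : Fin n → Fin n → Set) : ℕ → Fin n → Fin n → Set where
  here : ∀ {r x} → Reach E r x x
  step : ∀ {r x y z} → E x y → Reach E r y z → Reach E (suc r) x z

-- dist_𝒬(x,v) ≤ r : in every 𝒬-flip, x and v are at distance ≤ r
Ball : ∀ {n L} → Graph n → Partition n L → ℕ → Fin n → Fin n → Set
Ball {n} {L} G Q r v x =
  (F : L → L → Bool) → (∀ i j → F i j ≡ F j i) → Reach (flipAdj G Q F) r x v

-- S-refinement 𝒫 ∧ S : label of u is (P u, N(u) ∩ (S ∖ P(u)))
refine : ∀ {n} → Graph n → Partition n (Fin n) → Subset n → Partition n (Fin n × Subset n)
refine G P S u = P u , tabulate (λ w → adj G u w ∧ (Data.Vec.lookup S w ∧ not (does (P w ≟ᶠ P u))))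

-- Let A ⊆ V(G) be the set listed by the given cover of S ∩ Ball^{r+1}(v), so |A| ≤ ℓ. Two
-- vertices u, u' of Ball^r(v) in the same part of 𝒫 (hence of 𝒬) with N(u) ∩ A = N(u') ∩ A
-- get the same label in 𝒫 ∧ S: a vertex w ∈ S adjacent to exactly one of them is, in every
-- 𝒬-flip, adjacent or equal to one of them (both receive the same flips), so w lies in
-- Ball^{r+1}(v) and hence in A. On the ball the labels of 𝒫 ∧ S are therefore determined
-- by a part of 𝒫 meeting the ball (at most k choices) and a trace on A (at most π_G(ℓ)).
module Submission where

open import Defs hiding (sym)
open import Data.Nat using (ℕ; zero; suc; _+_; _*_; _≤_; _⊔_; z≤n; s≤s)
open import Data.Nat.Properties
  using (_≤?_; ≤-trans; ≤-reflexive; +-suc; +-monoʳ-≤; m≤m⊔n; m≤n⊔m; *-monoˡ-≤; *-monoʳ-≤)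
open import Data.Bool using (Bool; true; false; _∧_; _xor_; not)
open import Data.Bool.Properties using (∧-zeroʳ; ∧-identityʳ) renaming (_≟_ to _≟ᵇ_)
open import Data.Fin using (Fin; zero; suc)
open import Data.Fin.Properties using (any?; all?) renaming (_≟_ to _≟ᶠ_)
open import Data.Fin.Subset using (Subset; _∈_; _∩_; _∪_; ∣_∣; ⁅_⁆; ⊥; ⋃)
open import Data.Fin.Subset.Properties using (∣⊥∣≡0; ∣⁅x⁆∣≡1; ∣p∣≤∣x∷p∣; x∈⁅x⁆; x∈p∪q⁺)
open import Data.Vec using ([]; _∷_; lookup)
open import Data.Vec.Properties
  using (≡-dec; lookup∘tabulate; lookup-zipWith; tabulate-cong; lookup⇒[]=; []=⇒lookup)
open import Data.Vec.Functional as Vector using (Vector; head; tail)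
open import Data.Vec.Functional.Relation.Binary.Pointwise using (Pointwise)
open import Data.List
  using (List; []; _∷_; map; length; foldr; mapMaybe;
         cartesianProductWith; cartesianProduct)
open import Data.List.Properties using (length-++; length-map; length-mapMaybe)
open import Data.List.Membership.Propositional using () renaming (_∈_ to _∈ₗ_)
open import Data.List.Membership.Propositional.Properties
  using (∈-map⁺; ∈-deduplicate⁺; ∈-allFin; ∈-filter⁺; ∈-++⁺ˡ; ∈-++⁺ʳ; ∈-cartesianProductWith⁺)
open import Data.List.Relation.Unary.Any using (here; there)
open import Data.Maybe using (Maybe; just; nothing)
open import Data.Product using (_×_; _,_)
open import Data.Product.Properties using (,-injectiveˡ; ,-injectiveʳ) renaming (≡-dec to ×-≡-dec)
open import Data.Sum using (_⊎_; inj₁; inj₂)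
open import Data.Empty using (⊥-elim)
open import Level using (0ℓ)
open import Relation.Nullary using (Dec; yes; no; does)
import Relation.Nullary.Decidable as Dec
open import Relation.Nullary.Decidable using (_×-dec_; _→-dec_; ¬?; decidable-stable)
open import Relation.Unary using (Pred; Decidable)
open import Relation.Binary using (Rel; Reflexive; _Respects_; DecidableEquality)
open import Relation.Binary.PropositionalEquality
  using (_≡_; _≢_; refl; sym; trans; cong; cong₂; subst; module ≡-Reasoning)

-- Without function extensionality, an exhaustive search over functions can only decide
-- predicates that respect pointwise equality; hence the equivalence relation.
Exhaustible : (A : Set) → Rel A 0ℓ → Set₁
Exhaustible A _≈_ = {P : Pred A 0ℓ} → P Respects _≈_ → Decidable P → Dec (∀ a → P a)

Bool-exhaustible : Exhaustible Bool _≡_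
Bool-exhaustible _ P? with P? true | P? false
... | yes p₁ | yes p₀ = yes λ { true → p₁ ; false → p₀ }
... | no ¬p₁ | _      = no λ p → ¬p₁ (p true)
... | yes _  | no ¬p₀ = no λ p → ¬p₀ (p false)

Vector-exhaustible : {A : Set} {_≈_ : Rel A 0ℓ} → Reflexive _≈_ → Exhaustible A _≈_ →
                     ∀ m → Exhaustible (Vector A m) (Pointwise _≈_)
Vector-exhaustible ≈-refl ∀A? zero {P} resp P? =
  Dec.map′ (λ p f → resp (λ ()) p) (λ p → p Vector.[]) (P? Vector.[])
Vector-exhaustible {_≈_ = _≈_} ≈-refl ∀A? (suc m) {P} resp P? =
  Dec.map′ (λ p f → resp η (p (head f) (tail f))) (λ p a g → p (a Vector.∷ g))
           (∀A? resp-head ∀tail?)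
  where
  η : ∀ {f} → Pointwise _≈_ (head f Vector.∷ tail f) f
  η zero    = ≈-refl
  η (suc i) = ≈-refl

  resp-head : (λ a → ∀ g → P (a Vector.∷ g)) Respects _≈_
  resp-head a≈b p g = resp (λ { zero → a≈b ; (suc i) → ≈-refl }) (p g)

  ∀tail? : ∀ a → Dec (∀ g → P (a Vector.∷ g))
  ∀tail? a = Vector-exhaustible ≈-refl ∀A? m
    (λ g≈g' → resp (λ { zero → ≈-refl ; (suc i) → g≈g' i })) (λ g → P? (a Vector.∷ g))

module _ {n : ℕ} {E : Fin n → Fin n → Set} where

  Reach-suc : ∀ {r x y} → Reach E r x y → Reach E (suc r) x y
  Reach-suc here       = here
  Reach-suc (step e p) = step e (Reach-suc p)

  Reach? : (∀ x y → Dec (E x y)) → ∀ r x y → Dec (Reach E r x y)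
  Reach? E? r x y with x ≟ᶠ y
  Reach? E? r       x .x | yes refl = yes here
  Reach? E? zero    x y  | no x≢y   = no λ { here → x≢y refl }
  Reach? E? (suc r) x y  | no x≢y   with any? (λ z → E? x z ×-dec Reach? E? r z y)
  ... | yes (z , e , p) = yes (step e p)
  ... | no ∄z           = no λ { here → x≢y refl ; (step e p) → ∄z (_ , e , p) }

Reach-map : ∀ {n} {E E' : Fin n → Fin n → Set} → (∀ {x y} → E x y → E' x y) →
            ∀ {r x y} → Reach E r x y → Reach E' r x y
Reach-map f here       = here
Reach-map f (step e p) = step (f e) (Reach-map f p)

xor-≢ : ∀ {a a'} c → a ≢ a' → a xor c ≡ true ⊎ a' xor c ≡ true
xor-≢ {false} {false} _     a≢a' = ⊥-elim (a≢a' refl)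
xor-≢ {true}  {true}  _     a≢a' = ⊥-elim (a≢a' refl)
xor-≢ {false} {true}  false _    = inj₂ refl
xor-≢ {false} {true}  true  _    = inj₁ refl
xor-≢ {true}  {false} false _    = inj₁ refl
xor-≢ {true}  {false} true  _    = inj₂ refl

module _ {n m : ℕ} (G : Graph n) (Q : Partition n (Fin m)) where

  Ball? : ∀ r v x → Dec (Ball G Q r v x)
  Ball? r v x =
    Vector-exhaustible (λ _ → refl) (Vector-exhaustible refl Bool-exhaustible m) m
      resp (λ F → symmetric? F →-dec Reach? (flipAdj? F) r x v)
    where
    flipAdj? : ∀ F x y → Dec (flipAdj G Q F x y)
    flipAdj? F x y = ¬? (x ≟ᶠ y) ×-dec ((adj G x y xor F (Q x) (Q y)) ≟ᵇ true)

    symmetric? : ∀ F → Dec (∀ i j → F i j ≡ F j i)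
    symmetric? F = all? λ i → all? λ j → F i j ≟ᵇ F j i

    resp : (λ F → (∀ i j → F i j ≡ F j i) → Reach (flipAdj G Q F) r x v)
             Respects Pointwise (Pointwise _≡_)
    resp F≗F' p F'-sym = Reach-map
      (λ { {y} {z} (y≢z , e) → y≢z , trans (cong (adj G y z xor_) (sym (F≗F' (Q y) (Q z)))) e })
      (p λ i j → trans (F≗F' i j) (trans (F'-sym i j) (sym (F≗F' j i))))

  Reach-via-flip-neighbour : ∀ F {r v z w} → Reach (flipAdj G Q F) r z v →
                             (adj G z w xor F (Q w) (Q z)) ≡ true →
                             Reach (flipAdj G Q F) (suc r) w v
  Reach-via-flip-neighbour F {z = z} {w} p e with w ≟ᶠ z
  ... | yes refl = Reach-suc p
  ... | no w≢z   = step (w≢z , trans (cong (_xor F (Q w) (Q z)) (Graph.sym G w z)) e) p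

  -- u and u' receive the same flip, so in each flip w is a neighbour of one of them.
  separating-vertex-∈-Ball : ∀ {r v u u' w} → Ball G Q r v u → Ball G Q r v u' →
                             Q u ≡ Q u' → adj G u w ≢ adj G u' w → Ball G Q (suc r) v w
  separating-vertex-∈-Ball {u = u} {u'} {w} bu bu' Qu≡Qu' w-separates F F-sym
    with xor-≢ (F (Q w) (Q u)) w-separates
  ... | inj₁ e = Reach-via-flip-neighbour F (bu F F-sym) e
  ... | inj₂ e = Reach-via-flip-neighbour F (bu' F F-sym)
                   (subst (λ q → (adj G u' w xor F (Q w) q) ≡ true) Qu≡Qu' e)

fromList : ∀ {n} → List (Fin n) → Subset n
fromList xs = ⋃ (map ⁅_⁆ xs)

∈-fromList : ∀ {n} {x : Fin n} {xs} → x ∈ₗ xs → x ∈ fromList xs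
∈-fromList (here refl) = x∈p∪q⁺ (inj₁ (x∈⁅x⁆ _))
∈-fromList (there x∈) = x∈p∪q⁺ (inj₂ (∈-fromList x∈))

∣p∪q∣≤∣p∣+∣q∣ : ∀ {n} (p q : Subset n) → ∣ p ∪ q ∣ ≤ ∣ p ∣ + ∣ q ∣
∣p∪q∣≤∣p∣+∣q∣ []          []          = z≤n
∣p∪q∣≤∣p∣+∣q∣ (true ∷ p)  (y ∷ q)     =
  s≤s (≤-trans (∣p∪q∣≤∣p∣+∣q∣ p q) (+-monoʳ-≤ ∣ p ∣ (∣p∣≤∣x∷p∣ y q)))
∣p∪q∣≤∣p∣+∣q∣ (false ∷ p) (true ∷ q)  =
  ≤-trans (s≤s (∣p∪q∣≤∣p∣+∣q∣ p q)) (≤-reflexive (sym (+-suc ∣ p ∣ ∣ q ∣)))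
∣p∪q∣≤∣p∣+∣q∣ (false ∷ p) (false ∷ q) = ∣p∪q∣≤∣p∣+∣q∣ p q

∣fromList∣≤length : ∀ {n} (xs : List (Fin n)) → ∣ fromList xs ∣ ≤ length xs
∣fromList∣≤length {n} [] = ≤-reflexive (∣⊥∣≡0 n)
∣fromList∣≤length (x ∷ xs) =
  ≤-trans (∣p∪q∣≤∣p∣+∣q∣ ⁅ x ⁆ (fromList xs))
          (subst (λ c → c + _ ≤ suc (length xs)) (sym (∣⁅x⁆∣≡1 x)) (s≤s (∣fromList∣≤length xs)))

∈-allSubsets : ∀ {n} (p : Subset n) → p ∈ₗ allSubsets n
∈-allSubsets []              = here refl
∈-allSubsets (false ∷ p)     = ∈-++⁺ˡ (∈-map⁺ (false ∷_) (∈-allSubsets p))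
∈-allSubsets {suc n} (true ∷ p) =
  ∈-++⁺ʳ (map (false ∷_) (allSubsets n)) (∈-map⁺ (true ∷_) (∈-allSubsets p))

≤-foldr-⊔ : ∀ {x xs} → x ∈ₗ xs → x ≤ foldr _⊔_ 0 xs
≤-foldr-⊔ (here refl)             = m≤m⊔n _ _
≤-foldr-⊔ {xs = y ∷ _} (there x∈) = ≤-trans (≤-foldr-⊔ x∈) (m≤n⊔m y _)

traces≤π : ∀ {n} (G : Graph n) {A : Subset n} {ℓ} → ∣ A ∣ ≤ ℓ → traces G A ≤ π G ℓ
traces≤π G {A} {ℓ} ∣A∣≤ℓ =
  ≤-foldr-⊔ (∈-map⁺ (traces G) (∈-filter⁺ (λ B → ∣ B ∣ ≤? ℓ) (∈-allSubsets A) ∣A∣≤ℓ))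

module _ {n : ℕ} (G : Graph n) {A : Subset n} where

  lookup-N∩ : ∀ u {w} → w ∈ A → lookup (N G u ∩ A) w ≡ adj G u w
  lookup-N∩ u {w} w∈A = begin
    lookup (N G u ∩ A) w         ≡⟨ lookup-zipWith _∧_ w (N G u) A ⟩
    lookup (N G u) w ∧ lookup A w ≡⟨ cong₂ _∧_ (lookup∘tabulate (adj G u) w) ([]=⇒lookup w∈A) ⟩
    adj G u w ∧ true              ≡⟨ ∧-identityʳ _ ⟩
    adj G u w                     ∎
    where open ≡-Reasoning

  N∩-agree : ∀ {u u' w} → N G u ∩ A ≡ N G u' ∩ A → w ∈ A → adj G u w ≡ adj G u' w
  N∩-agree {u} {u'} {w} eq w∈A =
    trans (sym (lookup-N∩ u w∈A)) (trans (cong (λ t → lookup t w) eq) (lookup-N∩ u' w∈A))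

refine-determined : ∀ {n} (G : Graph n) (P : Partition n (Fin n)) (S : Subset n) {u u'} →
                    P u ≡ P u' → (∀ w → w ∈ S → adj G u w ≡ adj G u' w) →
                    refine G P S u ≡ refine G P S u'
refine-determined G P S {u} {u'} Pu≡Pu' agree = cong₂ _,_ Pu≡Pu' (tabulate-cong entry)
  where
  entry : ∀ w → adj G u w ∧ (lookup S w ∧ _) ≡ adj G u' w ∧ (lookup S w ∧ _)
  entry w with lookup S w in w∈S
  ... | false = trans (∧-zeroʳ _) (sym (∧-zeroʳ _))
  ... | true  = cong₂ _∧_ (agree w (lookup⇒[]= w S w∈S))
                          (cong (λ p → not (does (P w ≟ᶠ p))) Pu≡Pu')

AtMost-mono : ∀ {A : Set} {X : A → Set} {k m} → k ≤ m → AtMost k X → AtMost m X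
AtMost-mono k≤m (xs , len≤k , cover) = xs , ≤-trans len≤k k≤m , cover

length-cartesianProductWith : ∀ {A B C : Set} (f : A → B → C) xs ys →
  length (cartesianProductWith f xs ys) ≡ length xs * length ys
length-cartesianProductWith f []       ys = refl
length-cartesianProductWith f (x ∷ xs) ys =
  trans (length-++ (map (f x) ys))
        (cong₂ _+_ (length-map (f x) ys) (length-cartesianProductWith f xs ys))

∈-mapMaybe⁺ : ∀ {A B : Set} (f : A → Maybe B) {x y xs} →
              x ∈ₗ xs → f x ≡ just y → y ∈ₗ mapMaybe f xs
∈-mapMaybe⁺ f (here refl) fx≡y rewrite fx≡y = here refl
∈-mapMaybe⁺ f {xs = x ∷ _} (there x∈) fx≡y with f x
... | just _  = there (∈-mapMaybe⁺ f x∈ fx≡y)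
... | nothing = ∈-mapMaybe⁺ f x∈ fx≡y

module _ {n : ℕ} {X : Fin n → Set} where

  AtMost-/ₚ-pair : ∀ {L T : Set} {g : Partition n L} {h : Partition n T} {k} {D : List T} →
    AtMost k (X /ₚ g) → (∀ u → X u → h u ∈ₗ D) →
    AtMost (k * length D) (X /ₚ λ u → g u , h u)
  AtMost-/ₚ-pair {g = g} {h} {k} {D} (xs , len≤k , cover) h∈D =
    cartesianProduct xs D ,
    ≤-trans (≤-reflexive (length-cartesianProductWith _,_ xs D)) (*-monoˡ-≤ (length D) len≤k) ,
    λ { _ (u , Xu , refl) → ∈-cartesianProductWith⁺ _,_ (cover (g u) (u , Xu , refl)) (h∈D u Xu) }

  module _ {C B : Set} (_≟_ : DecidableEquality C) (X? : Decidable X)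
           (c : Partition n C) (f : Partition n B)
           (determined : ∀ {u u'} → X u → X u' → c u ≡ c u' → f u ≡ f u') where

    representative : C → Maybe B
    representative γ with any? (λ u → X? u ×-dec (c u ≟ γ))
    ... | yes (u , _) = just (f u)
    ... | no _        = nothing

    representative-c : ∀ {u} → X u → representative (c u) ≡ just (f u)
    representative-c {u} Xu with any? (λ u' → X? u' ×-dec (c u' ≟ c u))
    ... | yes (u' , Xu' , cu'≡cu) = cong just (determined Xu' Xu cu'≡cu)
    ... | no ∄u'                  = ⊥-elim (∄u' (u , Xu , refl))

    AtMost-/ₚ-determined : ∀ {k} → AtMost k (X /ₚ c) → AtMost k (X /ₚ f)
    AtMost-/ₚ-determined (xs , len≤k , cover) =
      mapMaybe representative xs ,
      ≤-trans (length-mapMaybe representative xs) len≤k ,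
      λ { _ (u , Xu , refl) →
            ∈-mapMaybe⁺ representative (cover (c u) (u , Xu , refl)) (representative-c Xu) }

lemma5p3 : {n : ℕ} (G : Graph n) (P Q : Partition n (Fin n)) (S : Subset n)
    (r k ℓ : ℕ) (v : Fin n) →
    P ⪯ Q →
    AtMost k (Ball G Q r v /ₚ P) →
    AtMost ℓ (λ x → x ∈ S × Ball G Q (suc r) v x) →
    AtMost (k * π G ℓ) (Ball G Q r v /ₚ refine G P S)
lemma5p3 {n} G P Q S r k ℓ v P⪯Q ball/P (Sball , length≤ℓ , Sball-cover) =
  AtMost-mono (*-monoʳ-≤ k (traces≤π G (≤-trans (∣fromList∣≤length Sball) length≤ℓ)))
    (AtMost-/ₚ-determined (×-≡-dec _≟ᶠ_ (≡-dec _≟ᵇ_)) (Ball? G Q r v) class (refine G P S)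
      class-determines-refine
      (AtMost-/ₚ-pair ball/P λ u _ →
        ∈-deduplicate⁺ (≡-dec _≟ᵇ_) (∈-map⁺ trace (∈-allFin u))))
  where
  A : Subset n
  A = fromList Sball

  trace : Fin n → Subset n
  trace u = N G u ∩ A

  class : Fin n → Fin n × Subset n
  class u = P u , trace u

  class-determines-refine : ∀ {u u'} → Ball G Q r v u → Ball G Q r v u' →
                            class u ≡ class u' → refine G P S u ≡ refine G P S u'
  class-determines-refine {u} {u'} bu bu' class≡ =
    refine-determined G P S Pu≡Pu' λ w w∈S →
      decidable-stable (adj G u w ≟ᵇ adj G u' w) λ w-separates →
        w-separates (N∩-agree G (,-injectiveʳ class≡) (∈-fromList (Sball-cover w
          (w∈S , separating-vertex-∈-Ball G Q bu bu' (P⪯Q u u' Pu≡Pu') w-separates))))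
    where
    Pu≡Pu' : P u ≡ P u'
    Pu≡Pu' = ,-injectiveˡ class≡
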